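{- The Primal-Dual by Frequency algorithm for Online Set Cover is monotone: at every moment, on every input, the assignment scheme it determines has an acyclic preference graph. Consequently it is priceable (can be mimicked exactly by a dynamic pricing algorithm).
   Context: Online Set Cover: a finite universe $X$, a family $\mathcal{S}=\{S_1,\dots,S_m\}\subseteq\mathcal{P}(X)$ with costs $c_S>0$, $\mathcal{S}_\eta=\{S\in\mathcal{S}:\eta\in S\}$; elements are requested online and each uncovered requested element must be covered by irrevocably purchasing a set of $\mathcal{S}_\eta$. Primal-Dual by Frequency: maintain a variable $y_\eta\ge0$ for each element (initially $0$), let $y_S=\sum_{\eta\in S}y_\eta$, and fix an ordering $S_1,\dots,S_m$ of the sets. When an uncovered element $\eta$ arrives, increase $y_\eta$ continuously until some $S\in\mathcal{S}_\eta$ satisfies $y_S=c_S$; then purchase the smallest-indexed set $S\in\mathcal{S}_\eta$ with $y_S=c_S$. Assignment scheme at a moment: the map $\mathcal{A}$ sending each uncovered element $\eta$ to the set the algorithm would purchase if $\eta$ were the next request; write $\eta\to_{\mathcal{A}}T$. Preference graph: directed graph on $\mathcal{S}$ with an edge $(S,T)$, $S\neq T$, whenever some uncovered $\eta\in S\cap T$ has $\eta\to_{\mathcal{A}}T$. An algorithm is monotone if all its assignment schemes have acyclic preference graphs. Dynamic pricing: before each request, surcharges $\rho(S)\ge0$ are set and a client requesting an uncovered $\eta$ purchases the set of $\mathcal{S}_\eta$ minimizing $\rho(S)+c_S$; an algorithm is priceable if some dynamic pricing algorithm produces, at every moment, prices under which each uncovered $\eta$'s unique price minimizer in $\mathcal{S}_\eta$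 is the set the algorithm would choose. -}

module Defs where

open import Data.Nat using (ℕ; zero; suc)
open import Data.Fin using (Fin; zero; suc)
import Data.Fin as Fin
open import Data.Fin.Subset using (Subset; _∈_)
open import Data.Fin.Subset.Properties using (_∈?_)
open import Data.Bool using (Bool; true; false; if_then_else_; _∧_)
open import Data.List using (List; []; _∷_; filter; map; foldl; head)
open import Data.Bool.ListAction using (any)
open import Data.List.Base using (allFin)
open import Data.Maybe using (Maybe; just; nothing)
open import Data.Product using (Σ; _×_; _,_)
open import Data.Rational using (ℚ; 0ℚ; _+_; _-_; _⊓_; _<_; _≤_)
open import Data.Rational.Properties using (_≟_)
open import Relation.Nullary using (¬_; does)
open import Relation.Binary.PropositionalEquality using (_≡_; _≢_)
open import Relation.Binary.Construct.Closure.Transitive using (TransClosure)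

sumFin : ∀ {k} → (Fin k → ℚ) → ℚ
sumFin {zero}  f = 0ℚ
sumFin {suc k} f = f zero + sumFin (λ i → f (suc i))

minL : List ℚ → Maybe ℚ
minL []       = nothing
minL (q ∷ qs) with minL qs
... | nothing = just q
... | just r  = just (q ⊓ r)

record State (n m : ℕ) : Set where
  constructor mkState
  field
    y      : Fin n → ℚ
    bought : Fin m → Bool
open State public

-- Primal-Dual by Frequency on the instance: universe X = Fin n,
-- sets S_1..S_m given by Sets : Fin m → Subset n (ordering = index order
-- of Fin m), costs c.
module PDF {n m : ℕ} (Sets : Fin m → Subset n) (c : Fin m → ℚ) where

  yS : (Fin n → ℚ) → Fin m → ℚ
  yS y i = sumFin (λ η → if does (η ∈? Sets i) then y η else 0ℚ)

  Covered : State n m → Fin n → Set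
  Covered st η = Σ (Fin m) λ i → bought st i ≡ true × η ∈ Sets i

  Uncovered : State n m → Fin n → Set
  Uncovered st η = ¬ Covered st η

  coveredB : State n m → Fin n → Bool
  coveredB st η = any (λ i → bought st i ∧ does (η ∈? Sets i)) (allFin m)

  candidates : Fin n → List (Fin m)
  candidates η = filter (λ i → η ∈? Sets i) (allFin m)

  -- amount by which y_η is raised continuously until some S ∈ 𝒮_η is tight
  δ : State n m → Fin n → Maybe ℚ
  δ st η = minL (map (λ i → c i - yS (y st) i) (candidates η))

  raise : (Fin n → ℚ) → Fin n → ℚ → (Fin n → ℚ)
  raise y η d x = if does (x Fin.≟ η) then y x + d else y x

  choice : State n m → Fin n → Maybe (Fin m)
  choice st η with δ st η
  ... | nothing = nothing
  ... | just d  = head (filter (λ i → yS (raise (y st) η d) i ≟ c i) (candidates η))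

  step : State n m → Fin n → State n m
  step st η with coveredB st η | δ st η | choice st η
  ... | true  | _      | _      = st
  ... | false | just d | just i =
        mkState (raise (y st) η d) (λ j → if does (j Fin.≟ i) then true else bought st j)
  ... | false | _      | _      = st

  initial : State n m
  initial = mkState (λ _ → 0ℚ) (λ _ → false)

  run : List (Fin n) → State n m
  run = foldl step initial

  -- assignment scheme: uncovered η ↦ set the algorithm would purchase
  -- if η were the next request
  _⇒[_]_ : Fin n → State n m → Fin m → Set
  η ⇒[ st ] T = Uncovered st η × choice st η ≡ just T

  Pref : State n m → Fin m → Fin m → Set
  Pref st S T = S ≢ T × Σ (Fin n) λ η → η ∈ Sets S × η ∈ Sets T × η ⇒[ st ] T

  Acyclic : State n m → Set
  Acyclic st = ∀ S → ¬ TransClosure (Pref st) S S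

  Monotone : Set
  Monotone = ∀ (rs : List (Fin n)) → Acyclic (run rs)

  -- priceable: a dynamic pricing algorithm (surcharges chosen online from
  -- the request history) such that at every moment each uncovered η's unique
  -- minimizer of ρ(S)+c_S over 𝒮_η is the set the algorithm would choose
  Priceable : Set
  Priceable =
    Σ (List (Fin n) → Fin m → ℚ) λ ρ →
      (∀ rs S → 0ℚ ≤ ρ rs S) ×
      (∀ rs η → Uncovered (run rs) η →
        Σ (Fin m) λ T → choice (run rs) η ≡ just T × η ∈ Sets T ×
          (∀ S → η ∈ Sets S → S ≢ T → ρ rs T + c T < ρ rs S + c S))

{-# OPTIONS --safe #-}
-- When η arrives, y_η rises by the least slack c_S − y_S over 𝒮_η, and the
-- first tight set is bought; so the set chosen for η is the minimum of 𝒮_η in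
-- the lexicographic order "smaller slack, then smaller index" taken at the
-- current y.  A preference edge S → T therefore puts T strictly below S in
-- this one strict order, so there is no cycle.  Pricing every S
-- so that ρ(S) + c_S = K + (number of sets below S), with K ≥ max c, makes the
-- chosen set the unique cheapest one.
module Submission where

open import Defs
open import Data.Nat using (ℕ)
open import Data.Fin using (Fin)
open import Data.Fin.Subset using (Subset; _∈_; _⊂_; ∣_∣)
open import Data.Product using (Σ; _×_; ∃; _,_; proj₁; proj₂)
open import Data.Rational using (ℚ; 0ℚ; _<_; _+_; _-_; -_; _≤_; _⊓_; *<*)

import Data.Nat as ℕ
import Data.Integer as ℤ
import Data.Integer.Properties as ℤ
import Data.Fin as F
import Data.Fin.Properties as F
import Data.Vec as Vec
open import Data.Vec.Properties using (lookup⇒[]=; []=⇒lookup; lookup∘tabulate)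
open import Data.Fin.Subset.Properties using (_∈?_; p⊂q⇒∣p∣<∣q∣)
open import Data.Bool using (if_then_else_)
open import Data.List using (List; []; _∷_; filter; head; allFin; tabulate)
open import Data.List.Membership.Propositional using () renaming (_∈_ to _∈ₗ_)
open import Data.List.Membership.Propositional.Properties
  using (∈-map⁺; ∈-map⁻; ∈-filter⁺; ∈-filter⁻; ∈-allFin)
open import Data.List.Relation.Unary.Any using (here; there)
open import Data.List.Relation.Unary.All as All using (All; []; _∷_)
import Data.List.Relation.Unary.All.Properties as All
open import Data.List.Relation.Unary.AllPairs using (AllPairs; _∷_)
import Data.List.Relation.Unary.AllPairs.Properties as AllPairs
open import Data.Maybe using (just; nothing)
open import Data.Product.Relation.Binary.Lex.Strict using (×-Lex; ×-strictTotalOrder)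
open import Data.Sum using (inj₁; inj₂)
open import Data.Empty using (⊥-elim)
open import Data.Rational.Literals using (fromℤ)
open import Data.Rational.Properties
open import Algebra.Properties.Group +-0-group using (//-rightDividesˡ; //-rightDividesʳ)
open import Algebra.Bundles using (CommutativeMonoid)
open import Algebra.Properties.CommutativeSemigroup
  (CommutativeMonoid.commutativeSemigroup +-0-commutativeMonoid) using (xy∙z≈xz∙y)
open import Function using (id; _∘_; _⇔_; mk⇔; Equivalence)
open import Level using (Level)
open import Relation.Nullary using (¬_; does; proof; yes; no)
open import Relation.Nullary.Decidable using (dec-true; dec-false)
open import Relation.Nullary.Reflects using (Reflects; invert)
open import Relation.Unary using (Pred; Decidable)
open import Relation.Binary using (Rel; Transitive; _⇒_; StrictTotalOrder; DecTotalOrder)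
import Relation.Binary as B
open import Relation.Binary.PropositionalEquality
open import Relation.Binary.Construct.Closure.Transitive using (TransClosure; [_]; _∷_)
open import Relation.Binary.Definitions using (tri<; tri≈; tri>)
import Data.List.Extrema (DecTotalOrder.totalOrder ≤-decTotalOrder) as Extrema

private
  variable
    a ℓ : Level
    A : Set a

minL≢nothing : ∀ {q qs} → q ∈ₗ qs → minL qs ≢ nothing
minL≢nothing {qs = _ ∷ qs} _ with minL qs
... | nothing = λ ()
... | just _  = λ ()

minL≡just⇒ : ∀ qs {d} → minL qs ≡ just d → d ∈ₗ qs × All (d ≤_) qs
minL≡just⇒ (q ∷ qs) e with minL qs in eq
minL≡just⇒ (q ∷ []) refl | nothing = here refl , ≤-refl ∷ []
minL≡just⇒ (q ∷ q′ ∷ qs) refl | nothing = ⊥-elim (minL≢nothing {qs = q′ ∷ qs} (here refl) eq)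
minL≡just⇒ (q ∷ qs) refl | just r
  with r∈qs , r≤qs ← minL≡just⇒ qs eq
  = q⊓r∈ , p⊓q≤p q r ∷ All.map (≤-trans (p⊓q≤q q r)) r≤qs
  where
  q⊓r∈ : q ⊓ r ∈ₗ q ∷ qs
  q⊓r∈ with ⊓-sel q r
  ... | inj₁ q⊓r≡q = here q⊓r≡q
  ... | inj₂ q⊓r≡r = there (subst (_∈ₗ qs) (sym q⊓r≡r) r∈qs)

∈⇒head≡just : ∀ {x : A} {xs} → x ∈ₗ xs → ∃ λ y → head xs ≡ just y
∈⇒head≡just {xs = y ∷ _} _ = y , refl

module _ {P : Pred A ℓ} (P? : Decidable P) where

  head-filter-least : ∀ {R : Rel A ℓ} {xs} → AllPairs R xs → ∀ {T} →
    head (filter P? xs) ≡ just T →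
    T ∈ₗ xs × P T × (∀ {S} → S ∈ₗ xs → P S → S ≢ T → R T S)
  head-filter-least {xs = x ∷ xs} (x<xs ∷ sorted) h with P? x
  head-filter-least {xs = x ∷ xs} (x<xs ∷ sorted) refl | yes px =
    here refl , px , λ where
      (here refl) _ S≢x → ⊥-elim (S≢x refl)
      (there S∈)  _ _   → All.lookup x<xs S∈
  head-filter-least {xs = x ∷ xs} (x<xs ∷ sorted) h | no ¬px
    with T∈ , pT , least ← head-filter-least sorted h =
    there T∈ , pT , λ where
      (here refl) pS _   → ⊥-elim (¬px pS)
      (there S∈)  pS S≢T → least S∈ pS S≢T

sumFin-cong : ∀ {k} {f g : Fin k → ℚ} → (∀ x → f x ≡ g x) → sumFin f ≡ sumFin g
sumFin-cong {ℕ.zero}  f≗g = refl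
sumFin-cong {ℕ.suc k} f≗g = cong₂ _+_ (f≗g F.zero) (sumFin-cong (f≗g ∘ F.suc))

sumFin-shift : ∀ {k} {f g : Fin k → ℚ} η {d} → g η ≡ f η + d →
  (∀ x → x ≢ η → g x ≡ f x) → sumFin g ≡ sumFin f + d
sumFin-shift {f = f} {g} F.zero {d} gη elsewhere = begin
  sumFin g                               ≡⟨ cong₂ _+_ gη (sumFin-cong (λ x → elsewhere (F.suc x) λ ())) ⟩
  f F.zero + d + sumFin (f ∘ F.suc)     ≡⟨ xy∙z≈xz∙y (f F.zero) d _ ⟩
  f F.zero + sumFin (f ∘ F.suc) + d     ∎
  where open ≡-Reasoning
sumFin-shift {f = f} {g} (F.suc η) {d} gη elsewhere = begin
  sumFin g                               ≡⟨ cong₂ _+_ (elsewhere F.zero λ ())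
                                             (sumFin-shift η gη (λ x x≢η → elsewhere (F.suc x) (x≢η ∘ F.suc-injective))) ⟩
  f F.zero + (sumFin (f ∘ F.suc) + d)   ≡⟨ +-assoc (f F.zero) _ d ⟨
  f F.zero + sumFin (f ∘ F.suc) + d     ∎
  where open ≡-Reasoning

TransClosure⇒ : ∀ {R _<_ : Rel A ℓ} → Transitive _<_ → R ⇒ _<_ → TransClosure R ⇒ _<_
TransClosure⇒ <-trans R⇒< [ r ]    = R⇒< r
TransClosure⇒ <-trans R⇒< (r ∷ rs) = <-trans (R⇒< r) (TransClosure⇒ <-trans R⇒< rs)

fromℕ : ℕ → ℚ
fromℕ k = fromℤ (ℤ.+ k)

fromℕ-mono-< : ∀ {j k} → j ℕ.< k → fromℕ j < fromℕ k
fromℕ-mono-< j<k = *<* (subst₂ ℤ._<_ (sym (ℤ.*-identityʳ _)) (sym (ℤ.*-identityʳ _)) (ℤ.+<+ j<k))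

fromℕ-nonNeg : ∀ k → 0ℚ ≤ fromℕ k
fromℕ-nonNeg k = nonNegative⁻¹ (fromℕ k)

module Rank {m} {_≺_ : Rel (Fin m) ℓ}
  (≺-irrefl : ∀ {S} → ¬ S ≺ S) (≺-trans : Transitive _≺_) (_≺?_ : B.Decidable _≺_) where

  strictLowerSet : Fin m → Subset m
  strictLowerSet S = Vec.tabulate (λ j → does (j ≺? S))

  ∈-strictLowerSet⁺ : ∀ {j S} → j ≺ S → j ∈ strictLowerSet S
  ∈-strictLowerSet⁺ {j} {S} j≺S =
    lookup⇒[]= j _ (trans (lookup∘tabulate _ j) (dec-true (j ≺? S) j≺S))

  ∈-strictLowerSet⁻ : ∀ {j S} → j ∈ strictLowerSet S → j ≺ S
  ∈-strictLowerSet⁻ {j} {S} j∈ =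
    invert (subst (Reflects _) (trans (sym (lookup∘tabulate _ j)) ([]=⇒lookup j∈)) (proof (j ≺? S)))

  strictLowerSet-⊂ : ∀ {T S} → T ≺ S → strictLowerSet T ⊂ strictLowerSet S
  strictLowerSet-⊂ T≺S =
    (λ j∈ → ∈-strictLowerSet⁺ (≺-trans (∈-strictLowerSet⁻ j∈) T≺S)) ,
    _ , ∈-strictLowerSet⁺ T≺S , ≺-irrefl ∘ ∈-strictLowerSet⁻

  rank : Fin m → ℕ
  rank S = ∣ strictLowerSet S ∣

  rank-mono-< : ∀ {T S} → T ≺ S → rank T ℕ.< rank S
  rank-mono-< = p⊂q⇒∣p∣<∣q∣ ∘ strictLowerSet-⊂

p≤q⇒0≤q-p : ∀ {p q} → p ≤ q → 0ℚ ≤ q - p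
p≤q⇒0≤q-p {p} {q} p≤q = subst (_≤ q - p) (+-inverseʳ p) (+-monoˡ-≤ (- p) p≤q)

module PrimalDualByFrequency {n m : ℕ} (Sets : Fin m → Subset n) (c : Fin m → ℚ) where
  open PDF Sets c

  slack : (Fin n → ℚ) → Fin m → ℚ
  slack y S = c S - yS y S

  yS-raise : ∀ y {η S} d → η ∈ Sets S → yS (raise y η d) S ≡ yS y S + d
  yS-raise y {η} {S} d η∈S = sumFin-shift η raisedAt raisedElsewhere
    where
    raisedAt : (if does (η ∈? Sets S) then raise y η d η else 0ℚ) ≡
               (if does (η ∈? Sets S) then y η else 0ℚ) + d
    raisedAt rewrite dec-true (η ∈? Sets S) η∈S | dec-true (η F.≟ η) refl = refl
    raisedElsewhere : ∀ x → x ≢ η → (if does (x ∈? Sets S) then raise y η d x else 0ℚ) ≡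
                                    (if does (x ∈? Sets S) then y x else 0ℚ)
    raisedElsewhere x x≢η rewrite dec-false (x F.≟ η) x≢η = refl

  raise-tight⇔ : ∀ y {η S} d → η ∈ Sets S → (yS (raise y η d) S ≡ c S) ⇔ (d ≡ slack y S)
  raise-tight⇔ y {S = S} d η∈S = mk⇔ tight⇒ ⇒tight
    where
    open ≡-Reasoning
    tight⇒ : yS (raise y _ d) S ≡ c S → d ≡ slack y S
    tight⇒ tight = begin
      d                   ≡⟨ //-rightDividesʳ (yS y S) d ⟨
      d + yS y S - yS y S ≡⟨ cong (_- yS y S) (+-comm d (yS y S)) ⟩
      yS y S + d - yS y S ≡⟨ cong (_- yS y S) (trans (sym (yS-raise y d η∈S)) tight) ⟩
      c S - yS y S        ∎
    ⇒tight : d ≡ slack y S → yS (raise y _ d) S ≡ c S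
    ⇒tight d≡slack = begin
      yS (raise y _ d) S  ≡⟨ yS-raise y d η∈S ⟩
      yS y S + d          ≡⟨ cong (yS y S +_) d≡slack ⟩
      yS y S + slack y S  ≡⟨ +-comm (yS y S) (slack y S) ⟩
      slack y S + yS y S  ≡⟨ //-rightDividesˡ (yS y S) (c S) ⟩
      c S                 ∎

  ∈-candidates⁺ : ∀ {η S} → η ∈ Sets S → S ∈ₗ candidates η
  ∈-candidates⁺ {η} {S} = ∈-filter⁺ (λ i → η ∈? Sets i) (∈-allFin S)

  ∈-candidates⁻ : ∀ {η S} → S ∈ₗ candidates η → η ∈ Sets S
  ∈-candidates⁻ {η} = proj₂ ∘ ∈-filter⁻ (λ i → η ∈? Sets i) {xs = allFin m}

  candidates-sorted : ∀ η → AllPairs F._<_ (candidates η)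
  candidates-sorted η = AllPairs.filter⁺ (λ i → η ∈? Sets i) (AllPairs.tabulate⁺-< id)

  slackThenIndex : StrictTotalOrder _ _ _
  slackThenIndex = ×-strictTotalOrder <-strictTotalOrder (F.<-strictTotalOrder m)

  module Lex = StrictTotalOrder slackThenIndex

  _≺[_]_ : Fin m → (Fin n → ℚ) → Fin m → Set
  T ≺[ y ] S = ×-Lex _≡_ _<_ F._<_ (slack y T , T) (slack y S , S)

  ≺-irrefl : ∀ y {S} → ¬ S ≺[ y ] S
  ≺-irrefl y = Lex.irrefl (refl , refl)

  ≺-trans : ∀ y → Transitive (_≺[ y ]_)
  ≺-trans y = Lex.trans

  ≺-dec : ∀ y → B.Decidable (_≺[ y ]_)
  ≺-dec y T S = (slack y T , T) Lex.<? (slack y S , S)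

  choice-least : ∀ {st η T} → choice st η ≡ just T →
    η ∈ Sets T × (∀ S → η ∈ Sets S → S ≢ T → T ≺[ y st ] S)
  choice-least {st} {η} {T} chosen with δ st η in δ≡d
  ... | just d
    with T∈ , tightT , firstTight ← head-filter-least (λ i → yS (raise (y st) η d) i ≟ c i)
                                      (candidates-sorted η) chosen
    = η∈T , least
    where
    η∈T : η ∈ Sets T
    η∈T = ∈-candidates⁻ T∈
    d≡slackT : d ≡ slack (y st) T
    d≡slackT = Equivalence.to (raise-tight⇔ (y st) d η∈T) tightT
    least : ∀ S → η ∈ Sets S → S ≢ T → T ≺[ y st ] S
    least S η∈S S≢T with <-cmp (slack (y st) T) (slack (y st) S)
    ... | tri< T<S _ _ = inj₁ T<S
    ... | tri≈ _ T≈S _ = inj₂ (T≈S , firstTight (∈-candidates⁺ η∈S)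
            (Equivalence.from (raise-tight⇔ (y st) d η∈S) (trans d≡slackT T≈S)) S≢T)
    ... | tri> _ _ S<T = ⊥-elim (<-irrefl refl (<-≤-trans S<T (subst (_≤ slack (y st) S) d≡slackT d≤S)))
      where
      d≤S : d ≤ slack (y st) S
      d≤S = All.lookup (All.map⁻ (proj₂ (minL≡just⇒ _ δ≡d))) (∈-candidates⁺ η∈S)

  choice-defined : ∀ st {η} → (Σ (Fin m) λ i → η ∈ Sets i) → ∃ λ T → choice st η ≡ just T
  choice-defined st {η} (i , η∈i) with δ st η in δ≡
  ... | nothing = ⊥-elim (minL≢nothing (∈-map⁺ (slack (y st)) (∈-candidates⁺ η∈i)) δ≡)
  ... | just d
    with S , S∈ , d≡slackS ← ∈-map⁻ (slack (y st)) (proj₁ (minL≡just⇒ _ δ≡))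
    = ∈⇒head≡just (∈-filter⁺ (λ j → yS (raise (y st) η d) j ≟ c j) S∈
        (Equivalence.from (raise-tight⇔ (y st) d (∈-candidates⁻ S∈)) d≡slackS))

  pref⇒≺ : ∀ {st S T} → Pref st S T → T ≺[ y st ] S
  pref⇒≺ (S≢T , η , η∈S , _ , _ , chosen) = proj₂ (choice-least chosen) _ η∈S S≢T

  monotone : Monotone
  monotone rs S cycle =
    ≺-irrefl y′ (TransClosure⇒ (λ T≺S U≺T → ≺-trans y′ U≺T T≺S) pref⇒≺ cycle)
    where y′ = y (run rs)

  module RankAt (y : Fin n → ℚ) = Rank (≺-irrefl y) (≺-trans y) (≺-dec y)

  costBound : ℚ
  costBound = Extrema.max 0ℚ (tabulate c)

  c≤costBound : ∀ S → c S ≤ costBound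
  c≤costBound = All.tabulate⁻ (Extrema.xs≤max 0ℚ (tabulate c))

  prices : List (Fin n) → Fin m → ℚ
  prices rs S = (costBound + fromℕ (RankAt.rank (y (run rs)) S)) - c S

  prices-nonNeg : ∀ rs S → 0ℚ ≤ prices rs S
  prices-nonNeg rs S = p≤q⇒0≤q-p (subst (_≤ costBound + fromℕ r) (+-identityʳ (c S))
    (+-mono-≤ (c≤costBound S) (fromℕ-nonNeg r)))
    where r = RankAt.rank (y (run rs)) S

  prices+c : ∀ rs S → prices rs S + c S ≡ costBound + fromℕ (RankAt.rank (y (run rs)) S)
  prices+c rs S = //-rightDividesˡ (c S) _

  priceable : (∀ η → Σ (Fin m) λ i → η ∈ Sets i) → Priceable
  priceable cover = prices , prices-nonNeg , λ rs η _ → chosenIsCheapest rs η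
    where
    chosenIsCheapest : ∀ rs η → Σ (Fin m) λ T → choice (run rs) η ≡ just T × η ∈ Sets T ×
      (∀ S → η ∈ Sets S → S ≢ T → prices rs T + c T < prices rs S + c S)
    chosenIsCheapest rs η
      with T , chosen ← choice-defined (run rs) (cover η)
      with η∈T , least ← choice-least chosen
      = T , chosen , η∈T , λ S η∈S S≢T →
        subst₂ _<_ (sym (prices+c rs T)) (sym (prices+c rs S))
          (+-monoʳ-< costBound (fromℕ-mono-< (RankAt.rank-mono-< (y (run rs)) (least S η∈S S≢T))))

lemma5 : ∀ {n m : ℕ} (Sets : Fin m → Subset n) (c : Fin m → ℚ) →
    (∀ i → 0ℚ < c i) →
    (∀ (η : Fin n) → Σ (Fin m) λ i → η ∈ Sets i) →
    PDF.Monotone Sets c × PDF.Priceable Sets c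
lemma5 Sets c _ cover = monotone , priceable cover
  where open PrimalDualByFrequency Sets c
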